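{- Let $k\ge1$, $n\ge T_k$ and $\lambda\in\Lambda_n$; write $\lambda(t)=\Phi^t(\lambda)$ and let $t^*$ be the smallest $t$ with $\lambda(t)\ge M^k$. Suppose that there is no time $t<t^*$ at which $\lambda(t)$ is a $q$-canonical configuration for some integer $q\ge2$. Then $t^*\le T_{k-1}$, i.e. $\Phi^{T_{k-1}}(\lambda)\ge M^k$.
   Context: $T_j=j(j+1)/2$. A mancala configuration is $\lambda:\mathbb N^*\to\mathbb N$ with support $\{1,\dots,\ell(\lambda)\}$; mass $|\lambda|=\sum\lambda_i$; $\Lambda_n$ the set of those of mass $n$. Move $\Phi$: $\mu=\Phi(\lambda)$, $\mu_i=\lambda_{i+1}+1$ for $1\le i\le\lambda_1$, $\mu_i=\lambda_{i+1}$ for $i>\lambda_1$. Marching group $M^j_i=j-i+1$ ($i\le j$), $0$ otherwise; order componentwise. Energy-level picture: $\lambda$ is identified with the occupied cells $\{(i,j): i\ge1,\ i\le j\le\lambda_i+i-1\}$; level $j$ consists of cells $(1,j),\dots,(j,j)$. If $\lambda\ge M^{q-1}$ but not $\lambda\ge M^q$, the empty cells of level $q$ are gaps. A gap in column $c$ of $\lambda$ is tracked as rotating left along level $q$: at time $t$ it is at column $c_t\in\{1,\dots,q\}$, $c_t\equiv c-t\pmod q$; it is filled at the first $t\ge1$ at which cell $(c_t,q)$ is occupied in $\Phi^t(\lambda)$ (filling is permanent; if $|\lambda|\ge T_q$ all gaps get filled, one at a time). For $q\ge2$, $\lambda$ with $|\lambda|\ge T_q$ is $q$-canonical if (1) $\lambda\ge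 M^{q-1}$, (2) $\ell(\lambda)=q-1$, and (3) the gap in column $q$ of level $q$ is the last gap of level $q$ to be filled. -}

module Defs where

open import Data.Nat using (ℕ; zero; suc; _+_; _*_; _∸_; _≤_; _<_; _≥_)
open import Data.List using (List; []; _∷_; length)
open import Data.Nat.ListAction using (sum)
open import Data.List.Relation.Unary.All using (All)
open import Data.Product using (_×_; Σ; ∃; _,_)
open import Relation.Nullary using (¬_)
open import Relation.Binary.PropositionalEquality using (_≡_; _≢_)

T : ℕ → ℕ
T zero    = 0
T (suc j) = suc j + T j

-- A mancala configuration λ is represented by the list [λ_1, …, λ_ℓ] of its
-- nonzero values (support {1,…,ℓ(λ)}); validity = all entries ≥ 1.
Config : Set
Config = List ℕ

IsConfig : Config → Set
IsConfig l = All (1 ≤_) l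

mass : Config → ℕ
mass = sum

len : Config → ℕ
len = length

InΛ : ℕ → Config → Set
InΛ n l = IsConfig l × mass l ≡ n

-- 1-based value λ_i (0 outside the support; λ_0 := 0 is never used)
val : Config → ℕ → ℕ
val []       _             = 0
val (x ∷ xs) zero          = 0
val (x ∷ xs) (suc zero)    = x
val (x ∷ xs) (suc (suc i)) = val xs (suc i)

addOnes : ℕ → List ℕ → List ℕ
addOnes zero    xs       = xs
addOnes (suc a) []       = 1 ∷ addOnes a []
addOnes (suc a) (x ∷ xs) = suc x ∷ addOnes a xs

-- The move Φ: μ_i = λ_{i+1}+1 for i ≤ λ_1, μ_i = λ_{i+1} for i > λ_1.
Φ : Config → Config
Φ []       = []
Φ (a ∷ xs) = addOnes a xs

Φ^ : ℕ → Config → Config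
Φ^ zero    l = l
Φ^ (suc t) l = Φ (Φ^ t l)

-- Marching group: M^j_i = j - i + 1 for 1 ≤ i ≤ j, 0 for i > j (i ≥ 1).
M : ℕ → ℕ → ℕ
M j i = suc j ∸ i

_≥M_ : Config → ℕ → Set
l ≥M j = ∀ i → 1 ≤ i → M j i ≤ val l i

Occupied : Config → ℕ → ℕ → Set
Occupied l i j = 1 ≤ i × i ≤ j × j < val l i + i

-- one left rotation step along level q (columns 1..q): c ↦ c-1, 1 ↦ q
leftStep : ℕ → ℕ → ℕ
leftStep q zero          = q
leftStep q (suc zero)    = q
leftStep q (suc (suc c)) = suc c

-- column c_t of a gap starting at column c: c_t ∈ {1..q}, c_t ≡ c - t (mod q)
colAt : ℕ → ℕ → ℕ → ℕ
colAt q c zero    = c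
colAt q c (suc t) = leftStep q (colAt q c t)

Gap : Config → ℕ → ℕ → Set
Gap l q c = 1 ≤ c × c ≤ q × ¬ Occupied l c q

FilledAt : Config → ℕ → ℕ → ℕ → Set
FilledAt l q c t =
  1 ≤ t × Occupied (Φ^ t l) (colAt q c t) q
  × (∀ s → 1 ≤ s → s < t → ¬ Occupied (Φ^ s l) (colAt q c s) q)

Canonical : ℕ → Config → Set
Canonical q l =
  2 ≤ q × mass l ≥ T q
  × l ≥M (q ∸ 1)
  × len l ≡ q ∸ 1
  × Gap l q q
  × Σ ℕ (λ tq → FilledAt l q q tq
        × (∀ c → Gap l q c → c ≢ q → Σ ℕ (λ tc → FilledAt l q c tc × tc < tq)))

-- Once λ ≥ M^{k-1}, the move Φ shifts level k one column to the left: cell (c+1,k) is occupied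
-- in λ iff cell (c,k) is occupied in Φ(λ). Hence a gap in column c of level k is at column
-- c − t at time t and is filled exactly at time c, when it has rotated round to column k. Let s be the first time with λ(s) ≥ M^{k-1}; by induction
-- s ≤ T_{k-2}, so it suffices to show t* ≤ s + k − 1. Otherwise put ν = λ(t* − k), which is
-- ≥ M^{k-1} because t* − k ≥ s. As Φ^{k-1}(ν) is not yet ≥ M^k but Φ^k(ν) is, cell (1,k)
-- of Φ^{k-1}(ν) is empty, so column k of level k is a gap of ν and ℓ(ν) = k − 1. Every gap
-- in column c is filled at time c, so the one in column k is filled last: ν is k-canonical.
module Submission where

open import Defs
open import Data.Nat using (ℕ; zero; suc; _+_; _≤_; _<_; _≥_; _∸_; z≤n; s≤s; _≤?_)
open import Data.Nat.Properties
open import Data.List using ([]; _∷_; length)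
open import Data.List.Relation.Unary.All using (_∷_)
open import Data.Product using (_×_; Σ; _,_; proj₁; proj₂)
open import Data.Empty using (⊥-elim)
open import Function.Bundles using (_⇔_; mk⇔; Equivalence)
open import Function.Construct.Composition using (_⇔-∘_)
open import Function.Construct.Identity using (⇔-id)
open import Relation.Nullary using (¬_; Dec; yes; no)
open import Relation.Nullary.Decidable using (map′)
open import Relation.Binary.PropositionalEquality
open import Algebra.Properties.CommutativeSemigroup +-commutativeSemigroup using (x∙yz≈y∙xz)

open Equivalence using (to; from)

mass-addOnes : ∀ a xs → mass (addOnes a xs) ≡ a + mass xs
mass-addOnes zero    xs       = refl
mass-addOnes (suc a) []       = cong suc (mass-addOnes a [])
mass-addOnes (suc a) (x ∷ xs) = cong suc (trans (cong (x +_) (mass-addOnes a xs)) (x∙yz≈y∙xz x a (mass xs)))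

mass-Φ : ∀ l → mass (Φ l) ≡ mass l
mass-Φ []       = refl
mass-Φ (a ∷ xs) = mass-addOnes a xs

mass-Φ^ : ∀ t l → mass (Φ^ t l) ≡ mass l
mass-Φ^ zero    l = refl
mass-Φ^ (suc t) l = trans (mass-Φ (Φ^ t l)) (mass-Φ^ t l)

addOnes-isConfig : ∀ a {xs} → IsConfig xs → IsConfig (addOnes a xs)
addOnes-isConfig zero    v       = v
addOnes-isConfig (suc a) {[]}     v       = s≤s z≤n ∷ addOnes-isConfig a v
addOnes-isConfig (suc a) {x ∷ xs} (_ ∷ v) = s≤s z≤n ∷ addOnes-isConfig a v

Φ-isConfig : ∀ {l} → IsConfig l → IsConfig (Φ l)
Φ-isConfig {[]}     v       = v
Φ-isConfig {a ∷ xs} (_ ∷ v) = addOnes-isConfig a v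

Φ^-isConfig : ∀ t {l} → IsConfig l → IsConfig (Φ^ t l)
Φ^-isConfig zero    v = v
Φ^-isConfig (suc t) v = Φ-isConfig (Φ^-isConfig t v)

Φ^-+ : ∀ a b l → Φ^ a (Φ^ b l) ≡ Φ^ (a + b) l
Φ^-+ zero    b l = refl
Φ^-+ (suc a) b l = cong Φ (Φ^-+ a b l)

val-addOnes : ∀ a xs {i} → suc i ≤ a → val (addOnes a xs) (suc i) ≡ suc (val xs (suc i))
val-addOnes (suc a) []       {zero}  _         = refl
val-addOnes (suc a) []       {suc i} (s≤s i<a) = val-addOnes a [] i<a
val-addOnes (suc a) (x ∷ xs) {zero}  _         = refl
val-addOnes (suc a) (x ∷ xs) {suc i} (s≤s i<a) = val-addOnes a xs i<a

val-Φ : ∀ l {i} → suc i ≤ val l 1 → val (Φ l) (suc i) ≡ suc (val l (suc (suc i)))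
val-Φ (a ∷ xs) = val-addOnes a xs

M-suc : ∀ {j i} → i ≤ j → M j i ≡ suc (M j (suc i))
M-suc = +-∸-assoc 1

M≤-beyond : ∀ j i {x} → j < i → M j i ≤ x
M≤-beyond j i {x} j<i = subst (_≤ x) (sym (m≤n⇒m∸n≡0 j<i)) z≤n

≥M-head : ∀ l {j} → l ≥M j → j ≤ val l 1
≥M-head l h = h 1 (s≤s z≤n)

≥M-suc⇒≥M : ∀ l {j} → l ≥M suc j → l ≥M j
≥M-suc⇒≥M l {j} h i 1≤i = ≤-trans (∸-monoˡ-≤ i (n≤1+n (suc j))) (h i 1≤i)

Φ-≥M : ∀ l {j} → l ≥M j → Φ l ≥M j
Φ-≥M l {j} h (suc i) _ with suc i ≤? j
... | no  i≮j = M≤-beyond j (suc i) (≰⇒> i≮j)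
... | yes i<j = begin
  M j (suc i)                ≡⟨ M-suc i<j ⟩
  suc (M j (suc (suc i)))    ≤⟨ s≤s (h (suc (suc i)) (s≤s z≤n)) ⟩
  suc (val l (suc (suc i)))  ≡⟨ val-Φ l (≤-trans i<j (≥M-head l h)) ⟨
  val (Φ l) (suc i)          ∎
  where open ≤-Reasoning

Φ^-≥M : ∀ t l {j} → l ≥M j → Φ^ t l ≥M j
Φ^-≥M zero    l h = h
Φ^-≥M (suc t) l h = Φ-≥M (Φ^ t l) (Φ^-≥M t l h)

Φ^-≥M-mono : ∀ l {a b j} → a ≤ b → Φ^ a l ≥M j → Φ^ b l ≥M j
Φ^-≥M-mono l {a} {b} a≤b h =
  subst (_≥M _) (trans (Φ^-+ (b ∸ a) a l) (cong (λ t → Φ^ t l) (m∸n+n≡m a≤b))) (Φ^-≥M (b ∸ a) (Φ^ a l) h)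

Φ-≥M⁻¹ : ∀ l {k} → Φ l ≥M suc k → suc k ≤ val l 1 → l ≥M suc k
Φ-≥M⁻¹ l     hΦ K≤l₁ (suc zero)    _ = K≤l₁
Φ-≥M⁻¹ l {k} hΦ K≤l₁ (suc (suc i)) _ with i ≤? k
... | no  i≰k = M≤-beyond (suc k) (suc (suc i)) (s≤s (s≤s (<⇒≤ (≰⇒> i≰k))))
... | yes i≤k = ≤-pred (begin
  suc (M (suc k) (suc (suc i)))  ≡⟨ M-suc (s≤s i≤k) ⟨
  M (suc k) (suc i)              ≤⟨ hΦ (suc i) (s≤s z≤n) ⟩
  val (Φ l) (suc i)              ≡⟨ val-Φ l (≤-trans (s≤s i≤k) K≤l₁) ⟩
  suc (val l (suc (suc i)))      ∎)
  where open ≤-Reasoning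

≥M-1 : ∀ {l} → IsConfig l → 1 ≤ mass l → l ≥M 1
≥M-1 {x ∷ xs} (1≤x ∷ _) _ (suc zero)    _ = 1≤x
≥M-1 {x ∷ xs} _         _ (suc (suc i)) _ = M≤-beyond 1 (suc (suc i)) (s≤s (s≤s z≤n))

_≥M?_ : ∀ l j → Dec (l ≥M j)
l ≥M? j = map′ bounded⇒≥M (λ h {i} _ → h (suc i) (s≤s z≤n))
               (allUpTo? (λ i → M j (suc i) ≤? val l (suc i)) (suc j))
  where
  bounded⇒≥M : (∀ {i} → i < suc j → M j (suc i) ≤ val l (suc i)) → l ≥M j
  bounded⇒≥M h (suc i) _ with i ≤? j
  ... | yes i≤j = h (s≤s i≤j)
  ... | no  i≰j = M≤-beyond j (suc i) (s≤s (<⇒≤ (≰⇒> i≰j)))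

FirstTime : (ℕ → Set) → ℕ → Set
FirstTime P t = P t × (∀ s → s < t → ¬ P s)

first-time : (P : ℕ → Set) → (∀ t → Dec (P t)) → ∀ t → P t → Σ ℕ λ s → s ≤ t × FirstTime P s
first-time P P? zero    Pt = 0 , z≤n , Pt , λ _ ()
first-time P P? (suc t) Pt with P? 0
... | yes P0 = 0 , z≤n , P0 , λ _ ()
... | no ¬P0 with first-time (λ i → P (suc i)) (λ i → P? (suc i)) t Pt
...   | s , s≤t , Ps , before = suc s , s≤s s≤t , Ps , earlier
  where
  earlier : ∀ r → r < suc s → ¬ P r
  earlier zero    _         = ¬P0
  earlier (suc r) (s≤s r<s) = before r r<s

Arrival : Config → ℕ → ℕ → Set
Arrival l j = FirstTime (λ t → Φ^ t l ≥M j)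

NoCanonicalBefore : ℕ → Config → Set
NoCanonicalBefore t l = ∀ s → s < t → ∀ q → 2 ≤ q → ¬ Canonical q (Φ^ s l)

Occupied-1⇔ : ∀ l {k} → Occupied l 1 (suc k) ⇔ suc k ≤ val l 1
Occupied-1⇔ l {k} = mk⇔ (λ (_ , _ , o) → ≤-pred (subst (suc k <_) (+-comm (val l 1) 1) o))
                          (λ K≤l₁ → s≤s z≤n , s≤s z≤n , subst (suc k <_) (+-comm 1 (val l 1)) (s≤s K≤l₁))

empty-diagonal⇒val≡0 : ∀ l {i} → ¬ Occupied l (suc i) (suc i) → val l (suc i) ≡ 0
empty-diagonal⇒val≡0 l {i} empty with val l (suc i)
... | zero  = refl
... | suc w = ⊥-elim (empty (s≤s z≤n , ≤-refl , m<n+m (suc i) (s≤s z≤n)))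

Occupied-Φ⇔ : ∀ l {k c} → l ≥M k → c < k →
              Occupied l (suc (suc c)) (suc k) ⇔ Occupied (Φ l) (suc c) (suc k)
Occupied-Φ⇔ l {k} {c} h c<k = mk⇔
  (λ (_ , _ , o) → s≤s z≤n , m≤n⇒m≤1+n c<k , subst (suc k <_) (sym heights) o)
  (λ (_ , _ , o) → s≤s z≤n , s≤s c<k , subst (suc k <_) heights o)
  where
  heights : val (Φ l) (suc c) + suc c ≡ val l (suc (suc c)) + suc (suc c)
  heights = trans (cong (_+ suc c) (val-Φ l (≤-trans c<k (≥M-head l h))))
                  (sym (+-suc (val l (suc (suc c))) (suc c)))

Occupied-Φ^⇔ : ∀ l {k} → l ≥M k → ∀ m {c} → suc c + m ≤ suc k →
               Occupied l (suc c + m) (suc k) ⇔ Occupied (Φ^ m l) (suc c) (suc k)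
Occupied-Φ^⇔ l h zero {c} _ rewrite +-identityʳ c = ⇔-id _
Occupied-Φ^⇔ l h (suc m) {c} fits rewrite +-suc c m =
  Occupied-Φ⇔ (Φ^ m l) (Φ^-≥M m l h) (≤-pred (m+n≤o⇒m≤o (suc (suc c)) fits)) ⇔-∘ Occupied-Φ^⇔ l h m fits

colAt-unwrapped : ∀ q r d → colAt q (suc (r + d)) r ≡ suc d
colAt-unwrapped q zero    d = refl
colAt-unwrapped q (suc r) d =
  cong (leftStep q) (trans (cong (λ x → colAt q (suc x) r) (sym (+-suc r d))) (colAt-unwrapped q r (suc d)))

colAt-wraps : ∀ q c → colAt q (suc c) (suc c) ≡ q
colAt-wraps q c =
  cong (leftStep q) (trans (cong (λ x → colAt q (suc x) c) (sym (+-identityʳ c))) (colAt-unwrapped q c 0))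

length-from-val : ∀ {l} k → IsConfig l → 1 ≤ val l (suc k) → val l (suc (suc k)) ≡ 0 → length l ≡ suc k
length-from-val {x ∷ []}     zero    _             _ _    = refl
length-from-val {x ∷ y ∷ ys} zero    (_ ∷ 1≤y ∷ _) _ refl with () ← 1≤y
length-from-val {x ∷ xs}     (suc k) (_ ∷ v)       p e    = cong suc (length-from-val k v p e)

module _ (m : ℕ) {ν : Config} (ν≥M : ν ≥M suc m)
         (late : ¬ Φ^ (suc m) ν ≥M suc (suc m)) (arrived : Φ^ (suc (suc m)) ν ≥M suc (suc m)) where

  private
    k = suc m
    K = suc k

  top-cell-gap : Gap ν K K
  top-cell-gap = s≤s z≤n , ≤-refl , λ o →
    late (Φ-≥M⁻¹ (Φ^ k ν) arrived (to (Occupied-1⇔ (Φ^ k ν)) (to (Occupied-Φ^⇔ ν ν≥M k ≤-refl) o)))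

  top-cell-occupied : ∀ t → 1 ≤ t → Occupied (Φ^ t ν) K K
  top-cell-occupied t 1≤t = from (Occupied-Φ^⇔ (Φ^ t ν) (Φ^-≥M t ν ν≥M) k ≤-refl)
                                 (from (Occupied-1⇔ (Φ^ k (Φ^ t ν))) (≥M-head (Φ^ k (Φ^ t ν)) K-reached))
    where
    K-reached : Φ^ k (Φ^ t ν) ≥M K
    K-reached = subst (_≥M K) (sym (Φ^-+ k t ν))
                      (Φ^-≥M-mono ν (subst (_≤ k + t) (+-comm k 1) (+-monoʳ-≤ k 1≤t)) arrived)

  gap-filled-at-own-column : ∀ c → Gap ν K c → FilledAt ν K c c
  gap-filled-at-own-column (suc c) (1≤c , c≤K , empty) =
    1≤c , subst (λ x → Occupied (Φ^ (suc c) ν) x K) (sym (colAt-wraps K c)) (top-cell-occupied (suc c) 1≤c) ,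
    still-empty
    where
    still-empty : ∀ s → 1 ≤ s → s < suc c → ¬ Occupied (Φ^ s ν) (colAt K (suc c) s) K
    still-empty s _ (s≤s s≤c) o with c ∸ s | m+[n∸m]≡n s≤c
    ... | d | refl = empty (subst (λ x → Occupied ν (suc x) K) (+-comm d s)
                             (from (Occupied-Φ^⇔ ν ν≥M s (subst (λ x → suc x ≤ K) (+-comm s d) c≤K))
                                   (subst (λ x → Occupied (Φ^ s ν) x K) (colAt-unwrapped K s d) o)))

  canonical-before-arrival : IsConfig ν → T K ≤ mass ν → Canonical K ν
  canonical-before-arrival v heavy =
    s≤s (s≤s z≤n) , heavy , ν≥M , length≡k , top-cell-gap ,
    K , gap-filled-at-own-column K top-cell-gap ,
    λ c gap c≢K → c , gap-filled-at-own-column c gap , ≤∧≢⇒< (proj₁ (proj₂ gap)) c≢K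
    where
    length≡k : length ν ≡ k
    length≡k = length-from-val m v (subst (_≤ val ν k) (m+n∸n≡m 1 k) (ν≥M k (s≤s z≤n)))
                                   (empty-diagonal⇒val≡0 ν (proj₂ (proj₂ top-cell-gap)))

next-arrival-within : ∀ m {l} → IsConfig l → T (suc (suc m)) ≤ mass l → ∀ {s D} →
                      Φ^ s l ≥M suc m → Arrival l (suc (suc m)) D → NoCanonicalBefore D l → D ≤ s + suc m
next-arrival-within m {l} v heavy {s} {D} s-reached (D-reached , not-yet) no-canonical with D ≤? s + suc m
... | yes D≤ = D≤
... | no  D≰ = ⊥-elim (no-canonical t t<D K (s≤s (s≤s z≤n)) (canonical-before-arrival m ν≥M late arrived
                         (Φ^-isConfig t v) (subst (T K ≤_) (sym (mass-Φ^ t l)) heavy)))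
  where
  k = suc m
  K = suc k
  s+K≤D : s + K ≤ D
  s+K≤D = subst (_≤ D) (sym (+-suc s k)) (≰⇒> D≰)
  t = D ∸ K
  t+K≡D : t + K ≡ D
  t+K≡D = m∸n+n≡m (m+n≤o⇒n≤o s s+K≤D)
  t<D : t < D
  t<D = subst (t <_) t+K≡D (m<m+n t (s≤s z≤n))
  ν = Φ^ t l
  ν≥M : ν ≥M k
  ν≥M = Φ^-≥M-mono l (m+n≤o⇒m≤o∸n s s+K≤D) s-reached
  late : ¬ Φ^ k ν ≥M K
  late h = not-yet (k + t) (subst (_< D) (+-comm t k) (subst (t + k <_) t+K≡D (+-monoʳ-< t (n<1+n k))))
                   (subst (_≥M K) (Φ^-+ k t l) h)
  arrived : Φ^ K ν ≥M K
  arrived = subst (_≥M K) (sym (trans (Φ^-+ K t l) (cong (λ x → Φ^ x l) (trans (+-comm K t) t+K≡D))))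
                  D-reached

arrival-bound : ∀ m {l} → IsConfig l → T (suc m) ≤ mass l → ∀ {D} →
                Arrival l (suc m) D → NoCanonicalBefore D l → D ≤ T m
arrival-bound zero    _ _     {zero}  _             _ = z≤n
arrival-bound zero    v heavy {suc D} (_ , not-yet) _ = ⊥-elim (not-yet 0 (s≤s z≤n) (≥M-1 v heavy))
arrival-bound (suc m) {l} v heavy {D} D-arrival@(D-reached , _) no-canonical = begin
  D            ≤⟨ next-arrival-within m v heavy s-reached D-arrival no-canonical ⟩
  s + suc m    ≤⟨ +-monoˡ-≤ (suc m) s≤T ⟩
  T m + suc m  ≡⟨ +-comm (T m) (suc m) ⟩
  T (suc m)    ∎
  where
  open ≤-Reasoning
  first = first-time (λ t → Φ^ t l ≥M suc m) (λ t → Φ^ t l ≥M? suc m) D (≥M-suc⇒≥M (Φ^ D l) D-reached)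
  s = proj₁ first
  s≤D = proj₁ (proj₂ first)
  s-arrival = proj₂ (proj₂ first)
  s-reached = proj₁ s-arrival
  s≤T : s ≤ T m
  s≤T = arrival-bound m v (≤-trans (m≤n+m (T (suc m)) (suc (suc m))) heavy) s-arrival
                      (λ t t<s → no-canonical t (<-≤-trans t<s s≤D))

mainTheorem15 : (k n : ℕ) → 1 ≤ k → n ≥ T k → (lam : Config) → InΛ n lam →
    (tstar : ℕ) → Φ^ tstar lam ≥M k → (∀ t → t < tstar → ¬ (Φ^ t lam ≥M k)) →
    (∀ t → t < tstar → ∀ q → 2 ≤ q → ¬ Canonical q (Φ^ t lam)) →
    tstar ≤ T (k ∸ 1) × Φ^ (T (k ∸ 1)) lam ≥M k
mainTheorem15 (suc m) _ _ n≥T lam (v , mass≡n) tstar reached not-yet no-canonical =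
  tstar≤T , Φ^-≥M-mono lam tstar≤T reached
  where
  tstar≤T : tstar ≤ T m
  tstar≤T = arrival-bound m v (subst (T (suc m) ≤_) (sym mass≡n) n≥T) (reached , not-yet) no-canonical
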